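{- Let $P$ be a path connected finite space. Then $\mathrm{CC}_m(P)\le\mathrm{cat}(P\times P)$ for all sufficiently large $m\ge0$.
   Context: A finite space is a finite $T_0$ topological space, identified with a finite poset (open sets are down-sets; continuous maps are order-preserving maps). $J_m$ is the finite fence on $\{0,\dots,m\}$ with order $0<1>2<\cdots m$; $P^{J_m}$ is the finite space of continuous maps $J_m\to P$ with the pointwise order; $q_m(\gamma)=(\gamma(0),\gamma(m))$. $\mathrm{CC}_m(P)$ is the smallest $n\ge0$ such that some open cover $\{Q_i\}_{i=1}^n$ of $P\times P$ admits continuous sections $Q_i\to P^{J_m}$ of $q_m$ ($\infty$ if none). For a space $X$, the (unreduced) LS-category $\mathrm{cat}(X)$ is the smallest $n\ge0$ such that $X$ can be covered by $n$ open subsets each of which is contractible in $X$ (its inclusion into $X$ is null-homotopic). -}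

module Defs where

open import Data.Nat using (ℕ; zero; suc; _%_)
open import Data.Fin using (Fin; toℕ; fromℕ) renaming (zero to fzero)
open import Data.Product using (Σ; ∃; _×_; _,_; proj₁; proj₂)
open import Data.Sum using (_⊎_)
open import Relation.Binary.PropositionalEquality using (_≡_)
open import Relation.Binary.Structures using (IsPartialOrder)
open import Relation.Binary.Definitions using (Decidable)

-- Finite spaces = finite posets (carrier Fin size); open sets are down-sets,
-- continuous maps are order-preserving maps.

record FiniteSpace : Set₁ where
  field
    size           : ℕ
    _≤_            : Fin size → Fin size → Set
    isPartialOrder : IsPartialOrder _≡_ _≤_
    _≤?_           : Decidable _≤_

  Pt : Set
  Pt = Fin size

Monotone : {A B : Set} → (A → A → Set) → (B → B → Set) → (A → B) → Set
Monotone _≤A_ _≤B_ f = ∀ {x y} → x ≤A y → f x ≤B f y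

Pointwise : {A B : Set} → (B → B → Set) → (A → B) → (A → B) → Set
Pointwise _≤B_ f g = ∀ a → f a ≤B g a

-- The fence J_m on {0,...,m} with 0 < 1 > 2 < 3 > ... : odd points are maximal,
-- i ≤ j iff i = j, or j is odd and |i - j| = 1.
_≤J_ : ∀ {m} → Fin (suc m) → Fin (suc m) → Set
i ≤J j = (toℕ i ≡ toℕ j)
       ⊎ ((toℕ j % 2 ≡ 1) × ((suc (toℕ i) ≡ toℕ j) ⊎ (toℕ i ≡ suc (toℕ j))))

Sub : {A : Set} → (A → Set) → Set
Sub {A} Q = Σ A Q

SubOrd : {A : Set} (_≤_ : A → A → Set) (Q : A → Set) → Sub Q → Sub Q → Set
SubOrd _≤_ Q u v = proj₁ u ≤ proj₁ v

-- Homotopy of continuous maps f g : A → X between finite spaces: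
-- a continuous map H : J_k → X^A (X^A with the pointwise order) with
-- H(0) = f and H(k) = g.
Homotopic : {A X : Set} → (A → A → Set) → (X → X → Set) → (A → X) → (A → X) → Set
Homotopic {A} {X} _≤A_ _≤X_ f g =
  Σ ℕ λ k → Σ (Fin (suc k) → A → X) λ H →
      (∀ i → Monotone _≤A_ _≤X_ (H i))
    × Monotone _≤J_ (Pointwise _≤X_) H
    × (∀ a → H fzero a ≡ f a)
    × (∀ a → H (fromℕ k) a ≡ g a)

module _ (P : FiniteSpace) where
  open FiniteSpace P

  _≤×_ : Pt × Pt → Pt × Pt → Set
  (a , b) ≤× (c , d) = (a ≤ c) × (b ≤ d)

  IsOpen² : (Pt × Pt → Set) → Set
  IsOpen² Q = ∀ {x y} → x ≤× y → Q y → Q x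

  ContractibleIn² : (Pt × Pt → Set) → Set
  ContractibleIn² Q =
    Σ (Pt × Pt) λ z₀ → Homotopic (SubOrd _≤×_ Q) _≤×_ proj₁ (λ _ → z₀)

  PathSpace : ℕ → Set
  PathSpace m = Σ (Fin (suc m) → Pt) (Monotone _≤J_ _≤_)

  _≤PS_ : ∀ {m} → PathSpace m → PathSpace m → Set
  γ ≤PS δ = Pointwise _≤_ (proj₁ γ) (proj₁ δ)

  q : (m : ℕ) → PathSpace m → Pt × Pt
  q m γ = (proj₁ γ fzero , proj₁ γ (fromℕ m))

  PathConnected : Set
  PathConnected = ∀ x y → Σ ℕ λ m → Σ (PathSpace m) λ γ → q m γ ≡ (x , y)

  HasSection : ℕ → (Pt × Pt → Set) → Set
  HasSection m Q = Σ (Sub Q → PathSpace m) λ s →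
      Monotone (SubOrd _≤×_ Q) _≤PS_ s × (∀ z → q m (s z) ≡ proj₁ z)

  -- an open cover of P × P by n sets, each contractible in P × P
  -- (so cat(P × P) ≤ n iff CatCover n)
  CatCover : ℕ → Set₁
  CatCover n = Σ (Fin n → Pt × Pt → Set) λ U →
      (∀ i → IsOpen² (U i)) × (∀ z → ∃ λ i → U i z) × (∀ i → ContractibleIn² (U i))

  -- an open cover of P × P by n sets, each admitting a continuous section of q_m
  -- (so CC_m(P) ≤ n iff CCCover m n)
  CCCover : ℕ → ℕ → Set₁
  CCCover m n = Σ (Fin n → Pt × Pt → Set) λ U →
      (∀ i → IsOpen² (U i)) × (∀ z → ∃ λ i → U i z) × (∀ i → HasSection m (U i))

{-# OPTIONS --safe #-}
-- A contraction of U ⊆ P × P is a fence of maps P × P → P × P from the identity to a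
-- constant (a , b). Over z = (x , y) ∈ U its two coordinates are fences from x to a and
-- from y to b depending monotonically on z; joined through a fixed fence from a to b they
-- give a continuous section of q_m over U. The length m must not depend on the cover:
-- since P and the set of maps P × P → P × P are finite, cutting out the loops between
-- repeated points shortens every such fence to a length bounded in terms of |P| alone.
-- Fences are modelled as zigzag sequences ℕ → X that are eventually constant.
module Submission where

open import Data.Nat using (ℕ; zero; suc; _+_; _*_; _∸_; _^_; _%_; _≤_; _<_; z≤n; s≤s; z<s; _≤?_)
open import Data.Nat.Properties
open import Data.Nat.Induction using (<-rec)
open import Data.Fin using (Fin; toℕ; fromℕ; funToFin; finToFun) renaming (zero to fzero; suc to fsuc)
open import Data.Fin.Properties using (pigeonhole; toℕ<n; toℕ-fromℕ; *↔×; finToFun-funToFin; any?)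
  renaming (_≟_ to _≟ᶠ_)
open import Data.Product using (Σ; ∃; ∃₂; _×_; _,_; proj₁; proj₂)
open import Data.Sum using (inj₁; inj₂)
open import Data.Empty using (⊥-elim)
open import Function using (_∘_; id; _↔_; Inverse)
open import Level using (Level; 0ℓ)
open import Relation.Binary using (Rel; Reflexive; _Respects₂_; _=[_]⇒_; tri<; tri≈; tri>)
open import Relation.Binary.PropositionalEquality
  using (_≡_; refl; sym; trans; cong; cong₂; subst; subst₂; _≗_; resp₂; module ≡-Reasoning)
open import Relation.Binary.Structures using (IsPartialOrder)
open import Relation.Nullary using (yes; no)
open import Relation.Nullary.Decidable using (_×-dec_; map′)
open import Relation.Unary using (Pred; Decidable; _⊆_)
open import Defs

private
  variable
    a r : Level
    X Y : Set a

double : ℕ → ℕ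
double zero    = zero
double (suc n) = suc (suc (double n))

double-+ : ∀ m n → double (m + n) ≡ double m + double n
double-+ zero    n = refl
double-+ (suc m) n = cong (suc ∘ suc) (double-+ m n)

double-mono-≤ : ∀ {m n} → m ≤ n → double m ≤ double n
double-mono-≤ z≤n       = z≤n
double-mono-≤ (s≤s m≤n) = s≤s (s≤s (double-mono-≤ m≤n))

-- Alt R t relates the points t and t + 1 of a fence 0 < 1 > 2 < 3 > ⋯ ordered by R.
module _ {X : Set a} (R : Rel X r) where

  Alt : ℕ → Rel X r
  Alt zero          x y = R x y
  Alt (suc zero)    x y = R y x
  Alt (suc (suc t)) x y = Alt t x y

  Zigzag : (ℕ → X) → Set r
  Zigzag f = ∀ t → Alt t (f t) (f (suc t))

module _ {X : Set a} {R : Rel X r} where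

  alt-refl : Reflexive R → ∀ t {x} → Alt R t x x
  alt-refl refl′ zero          = refl′
  alt-refl refl′ (suc zero)    = refl′
  alt-refl refl′ (suc (suc t)) = alt-refl refl′ t

  alt-+double : ∀ e t {x y} → Alt R (double e + t) x y → Alt R t x y
  alt-+double zero    t xy = xy
  alt-+double (suc e) t xy = alt-+double e t xy

  alt-double : ∀ e {x y} → R x y → Alt R (double e) x y
  alt-double zero    xy = xy
  alt-double (suc e) xy = alt-double e xy

  alt-suc-double : ∀ e {x y} → R y x → Alt R (suc (double e)) x y
  alt-suc-double zero    yx = yx
  alt-suc-double (suc e) yx = alt-suc-double e yx

  alt-complement : ∀ e s t {x y} → s + suc t ≡ double e → Alt R s x y → Alt R t y x
  alt-complement (suc e) zero t eq xy =
    subst (λ u → Alt R u _ _) (sym (suc-injective eq)) (alt-suc-double e xy)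
  alt-complement (suc e) (suc zero) t eq yx =
    subst (λ u → Alt R u _ _) (sym (suc-injective (suc-injective eq))) (alt-double e yx)
  alt-complement (suc e) (suc (suc s)) t eq xy =
    alt-complement e s t (suc-injective (suc-injective eq)) xy

  alt-intro : ∀ t {x y} → (suc t % 2 ≡ 1 → R x y) → (t % 2 ≡ 1 → R y x) → Alt R t x y
  alt-intro zero          up down = up refl
  alt-intro (suc zero)    up down = down refl
  alt-intro (suc (suc t)) up down = alt-intro t up down

  alt-up : ∀ t {x y} → suc t % 2 ≡ 1 → Alt R t x y → R x y
  alt-up zero          _  xy = xy
  alt-up (suc zero)    ()
  alt-up (suc (suc t)) even xy = alt-up t even xy

  alt-down : ∀ t {x y} → t % 2 ≡ 1 → Alt R t x y → R y x
  alt-down zero          ()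
  alt-down (suc zero)    _  yx = yx
  alt-down (suc (suc t)) odd xy = alt-down t odd xy

alt-map : ∀ {R : Rel X r} {S : Rel Y r} (f : X → Y) → R =[ f ]⇒ S → ∀ t → Alt R t =[ f ]⇒ Alt S t
alt-map f hom zero          = hom
alt-map f hom (suc zero)    = hom
alt-map f hom (suc (suc t)) = alt-map f hom t

alt-pointwise : ∀ {A B : Set} {R : B → B → Set} t {g h : A → B} →
                (∀ x → Alt R t (g x) (h x)) → Alt (Pointwise R) t g h
alt-pointwise zero          gh = gh
alt-pointwise (suc zero)    gh = gh
alt-pointwise (suc (suc t)) gh = alt-pointwise t gh

zigzag-+double : ∀ {R : Rel X r} {f : ℕ → X} → Zigzag R f → ∀ e → Zigzag R (f ∘ (double e +_))
zigzag-+double {R = R} {f} zf e t =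
  subst (Alt R t (f (double e + t)) ∘ f) (sym (+-suc (double e) t))
    (alt-+double e t (zf (double e + t)))

pointwise-resp-≗ : ∀ {A B : Set} {R : B → B → Set} → Pointwise {A} R Respects₂ _≗_
pointwise-resp-≗ {R = R} =
  (λ {g} h≗h′ g≤h x → subst (R (g x)) (h≗h′ x) (g≤h x)) ,
  (λ {h} g≗g′ g≤h x → subst (λ u → R u (h x)) (g≗g′ x) (g≤h x))

clamp : (k t : ℕ) → Fin (suc k)
clamp zero    t       = fzero
clamp (suc k) zero    = fzero
clamp (suc k) (suc t) = fsuc (clamp k t)

clamp-zero : ∀ k → clamp k 0 ≡ fzero
clamp-zero zero    = refl
clamp-zero (suc k) = refl

toℕ-clamp : ∀ {k t} → t ≤ k → toℕ (clamp k t) ≡ t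
toℕ-clamp {zero}  {zero}  _         = refl
toℕ-clamp {suc k} {zero}  _         = refl
toℕ-clamp {suc k} {suc t} (s≤s t≤k) = cong suc (toℕ-clamp t≤k)

clamp-top : ∀ {k t} → k ≤ t → clamp k t ≡ fromℕ k
clamp-top {zero}              _         = refl
clamp-top {suc k} {suc t} (s≤s k≤t) = cong fsuc (clamp-top k≤t)

clamp-zigzag : ∀ k → Zigzag (_≤J_ {k}) (clamp k)
clamp-zigzag k t with suc t ≤? k
... | yes t<k = alt-intro t
  (λ odd → inj₂ (subst (λ u → u % 2 ≡ 1) (sym t+1) odd , inj₁ (trans (cong suc t′) (sym t+1))))
  (λ odd → inj₂ (subst (λ u → u % 2 ≡ 1) (sym t′) odd , inj₂ (trans t+1 (cong suc (sym t′)))))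
  where
  t′ : toℕ (clamp k t) ≡ t
  t′ = toℕ-clamp (<⇒≤ t<k)
  t+1 : toℕ (clamp k (suc t)) ≡ suc t
  t+1 = toℕ-clamp t<k
... | no t≮k = subst (Alt _≤J_ t (clamp k t))
  (trans (clamp-top k≤t) (sym (clamp-top (m≤n⇒m≤1+n k≤t))))
  (alt-refl (inj₁ refl) t)
  where
  k≤t : k ≤ t
  k≤t = ≤-pred (≰⇒> t≮k)

zigzag⇒monotone : ∀ {X : Set} {R : X → X → Set} {f : ℕ → X} → Reflexive R → Zigzag R f →
                  ∀ m → Monotone (_≤J_ {m}) R (f ∘ toℕ)
zigzag⇒monotone {R = R} {f} refl′ zf m {i} {j} (inj₁ i≡j) =
  subst (R (f (toℕ i)) ∘ f) i≡j refl′
zigzag⇒monotone {R = R} {f} refl′ zf m {i} {j} (inj₂ (odd , inj₁ i+1≡j)) =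
  subst (R (f (toℕ i)) ∘ f) i+1≡j
    (alt-up (toℕ i) (subst (λ u → u % 2 ≡ 1) (sym i+1≡j) odd) (zf (toℕ i)))
zigzag⇒monotone {R = R} {f} refl′ zf m {i} {j} (inj₂ (odd , inj₂ i≡j+1)) =
  subst (λ u → R (f u) (f (toℕ j))) (sym i≡j+1) (alt-down (toℕ j) odd (zf (toℕ j)))

splice : ℕ → (ℕ → X) → (ℕ → X) → ℕ → X
splice zero    p q             = q
splice (suc e) p q zero          = p 0
splice (suc e) p q (suc zero)    = p 1
splice (suc e) p q (suc (suc t)) = splice e (p ∘ suc ∘ suc) q t

splice-zero : ∀ e (p q : ℕ → X) → p (double e) ≡ q 0 → splice e p q 0 ≡ p 0
splice-zero zero    p q pq = sym pq
splice-zero (suc e) p q pq = refl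

splice-+double : ∀ e (p q : ℕ → X) t → splice e p q (double e + t) ≡ q t
splice-+double zero    p q t = refl
splice-+double (suc e) p q t = splice-+double e (p ∘ suc ∘ suc) q t

splice-zigzag : ∀ {R : Rel X r} e {p q : ℕ → X} → Zigzag R p → Zigzag R q →
                p (double e) ≡ q 0 → Zigzag R (splice e p q)
splice-zigzag zero    zp zq pq = zq
splice-zigzag (suc e) zp zq pq zero = zp 0
splice-zigzag {R = R} (suc e) {p} {q} zp zq pq (suc zero) =
  subst (Alt R 1 (p 1)) (sym (splice-zero e (p ∘ suc ∘ suc) q pq)) (zp 1)
splice-zigzag (suc e) zp zq pq (suc (suc t)) =
  splice-zigzag e (zp ∘ suc ∘ suc) zq pq t

splice-pointwise : ∀ {X : Set} {R : X → X → Set} e {p p′ q q′ : ℕ → X} →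
                   Pointwise R p p′ → Pointwise R q q′ →
                   Pointwise R (splice e p q) (splice e p′ q′)
splice-pointwise zero    pp qq = qq
splice-pointwise (suc e) pp qq zero          = pp 0
splice-pointwise (suc e) pp qq (suc zero)    = pp 1
splice-pointwise {R = R} (suc e) pp qq (suc (suc t)) =
  splice-pointwise {R = R} e (pp ∘ suc ∘ suc) qq t

reverse : ℕ → (ℕ → X) → ℕ → X
reverse e h t = h (double e ∸ t)

reverse-zigzag : ∀ {R : Rel X r} e {h : ℕ → X} → Reflexive R → Zigzag R h → Zigzag R (reverse e h)
reverse-zigzag {R = R} e {h} refl′ zh t with suc t ≤? double e
... | yes t<2e =
  subst (λ u → Alt R t (h u) (h (double e ∸ suc t))) (sym (+-∸-assoc 1 t<2e))
    (alt-complement e (double e ∸ suc t) t (trans (+-comm _ (suc t)) (m+[n∸m]≡n t<2e))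
      (zh (double e ∸ suc t)))
... | no t≮2e = subst₂ (λ u v → Alt R t (h u) (h v))
  (sym (m≤n⇒m∸n≡0 2e≤t)) (sym (m≤n⇒m∸n≡0 (m≤n⇒m≤1+n 2e≤t)))
  (alt-refl refl′ t)
  where
  2e≤t : double e ≤ t
  2e≤t = ≤-pred (≰⇒> t≮2e)

reverse-+double : ∀ e (h : ℕ → X) t → reverse e h (double e + t) ≡ h 0
reverse-+double e h t = cong h (m≤n⇒m∸n≡0 (m≤m+n (double e) t))

skip : ℕ → ℕ → ℕ → ℕ
skip a d t with t ≤? a
... | yes _ = t
... | no _  = d + t

skip-≤ : ∀ {a d t} → t ≤ a → skip a d t ≡ t
skip-≤ {a} {d} {t} t≤a with t ≤? a
... | yes _   = refl
... | no t≰a = ⊥-elim (t≰a t≤a)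

skip-> : ∀ {a d t} → a < t → skip a d t ≡ d + t
skip-> {a} {d} {t} a<t with t ≤? a
... | yes t≤a = ⊥-elim (<⇒≱ a<t t≤a)
... | no _    = refl

-- Points are coded in Fin n injectively up to ≈, so by pigeonhole two of the valleys
-- f 0, f 2, …, f (2n) of a zigzag f agree, and the loop between them can be skipped.
module LoopErasure {c ℓ r} {Carrier : Set c} (_≈_ : Rel Carrier ℓ)
  {_⊑_ : Rel Carrier r} (⊑-resp-≈ : _⊑_ Respects₂ _≈_)
  {n : ℕ} (code : Carrier → Fin n) (code-injective : ∀ {x y} → code x ≡ code y → x ≈ y) where

  alt-respˡ : ∀ t {x x′ y} → x ≈ x′ → Alt _⊑_ t x y → Alt _⊑_ t x′ y
  alt-respˡ zero          x≈x′ = proj₂ ⊑-resp-≈ x≈x′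
  alt-respˡ (suc zero)    x≈x′ = proj₁ ⊑-resp-≈ x≈x′
  alt-respˡ (suc (suc t)) x≈x′ = alt-respˡ t x≈x′

  skip-zigzag : ∀ {f : ℕ → Carrier} a e → f (double e + a) ≈ f a → Zigzag _⊑_ f →
                Zigzag _⊑_ (f ∘ skip a (double e))
  skip-zigzag {f} a e loop zf t with <-cmp t a
  ... | tri< t<a _ _ = subst₂ (Alt _⊑_ t)
    (cong f (sym (skip-≤ (<⇒≤ t<a)))) (cong f (sym (skip-≤ t<a))) (zf t)
  ... | tri≈ _ refl _ = subst₂ (Alt _⊑_ t)
    (cong f (sym (skip-≤ ≤-refl))) (cong f (sym (skip-> (n<1+n t))))
    (alt-respˡ t loop (zigzag-+double zf e t))
  ... | tri> _ _ a<t = subst₂ (Alt _⊑_ t)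
    (cong f (sym (skip-> a<t))) (cong f (sym (skip-> (m<n⇒m<1+n a<t)))) (zigzag-+double zf e t)

  record Shortcut (f : ℕ → Carrier) (k : ℕ) : Set r where
    field
      reindex      : ℕ → ℕ
      reindex-zero : reindex 0 ≡ 0
      zigzag       : Zigzag _⊑_ (f ∘ reindex)
      reaches      : ∀ t → double n ≤ t → k ≤ reindex t

  repeatedValley : (f : ℕ → Carrier) →
                   ∃₂ λ a e → f (double (suc e) + a) ≈ f a × double (suc e) + a ≤ double n
  repeatedValley f with pigeonhole (n<1+n n) (λ i → code (f (double (toℕ i))))
  ... | i , j , i<j , same with m≤n⇒∃[o]m+o≡n i<j
  ... | e , i+1+e≡j =
    double (toℕ i) , e , loop , subst (_≤ double n) j≡i+1+e (double-mono-≤ (≤-pred (toℕ<n j)))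
    where
    j≡i+1+e : double (toℕ j) ≡ double (suc e) + double (toℕ i)
    j≡i+1+e = begin
      double (toℕ j)                       ≡⟨ cong double i+1+e≡j ⟨
      double (suc (toℕ i + e))             ≡⟨ cong (double ∘ suc) (+-comm (toℕ i) e) ⟩
      double (suc e + toℕ i)               ≡⟨ double-+ (suc e) (toℕ i) ⟩
      double (suc e) + double (toℕ i)      ∎
      where open ≡-Reasoning
    loop : f (double (suc e) + double (toℕ i)) ≈ f (double (toℕ i))
    loop = subst (λ u → f u ≈ f (double (toℕ i))) j≡i+1+e (code-injective (sym same))

  skipShortcut : ∀ {f k} a d → d + a < k → Shortcut (f ∘ skip a d) (k ∸ d) → Shortcut f k
  skipShortcut {f} {k} a d d+a<k s = record
    { reindex      = skip a d ∘ reindex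
    ; reindex-zero = trans (cong (skip a d) reindex-zero) (skip-≤ {a} {d} z≤n)
    ; zigzag       = zigzag
    ; reaches      = λ t 2n≤t → beyond (reaches t 2n≤t)
    }
    where
    open Shortcut s
    a<k∸d : a < k ∸ d
    a<k∸d = m+n≤o⇒m≤o∸n (suc a) (subst (_< k) (+-comm d a) d+a<k)
    beyond : ∀ {u} → k ∸ d ≤ u → k ≤ skip a d u
    beyond {u} k∸d≤u = begin
      k             ≤⟨ m≤n+m∸n k d ⟩
      d + (k ∸ d)   ≤⟨ +-monoʳ-≤ d k∸d≤u ⟩
      d + u         ≡⟨ skip-> (<-≤-trans a<k∸d k∸d≤u) ⟨
      skip a d u    ∎
      where open ≤-Reasoning

  shortcut : ∀ k f → Zigzag _⊑_ f → Shortcut f k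
  shortcut = <-rec _ step
    where
    step : ∀ k → (∀ {k′} → k′ < k → ∀ f → Zigzag _⊑_ f → Shortcut f k′) →
           ∀ f → Zigzag _⊑_ f → Shortcut f k
    step k rec f zf with k ≤? double n
    ... | yes k≤2n = record
      { reindex = id ; reindex-zero = refl ; zigzag = zf ; reaches = λ t → ≤-trans k≤2n }
    ... | no k≰2n with repeatedValley f
    ... | a , e , loop , bound = skipShortcut a d d+a<k
          (rec (∸-monoʳ-< {k} {d} {0} z<s (≤-trans (m≤m+n d a) (<⇒≤ d+a<k)))
               (f ∘ skip a d) (skip-zigzag a (suc e) loop zf))
      where
      d : ℕ
      d = double (suc e)
      d+a<k : d + a < k
      d+a<k = <-≤-trans (s≤s bound) (≰⇒> k≰2n)

module _ {A B : Set} {m n : ℕ} (A↔ : Fin m ↔ A) (B↔ : Fin n ↔ B) where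
  open Inverse

  funCode : (A → B) → Fin (n ^ m)
  funCode g = funToFin (from B↔ ∘ g ∘ to A↔)

  funCode-injective : ∀ {g h} → funCode g ≡ funCode h → g ≗ h
  funCode-injective {g} {h} same x = begin
    g x                                ≡⟨ strictlyInverseˡ B↔ (g x) ⟨
    to B↔ (from B↔ (g x))              ≡⟨ cong (to B↔ ∘ from B↔ ∘ g) (strictlyInverseˡ A↔ x) ⟨
    to B↔ (from B↔ (g (to A↔ i)))      ≡⟨ cong (to B↔) (finToFun-funToFin _ i) ⟨
    to B↔ (finToFun (funCode g) i)     ≡⟨ cong (λ c → to B↔ (finToFun c i)) same ⟩
    to B↔ (finToFun (funCode h) i)     ≡⟨ cong (to B↔) (finToFun-funToFin _ i) ⟩
    to B↔ (from B↔ (h (to A↔ i)))      ≡⟨ cong (to B↔ ∘ from B↔ ∘ h) (strictlyInverseˡ A↔ x) ⟩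
    to B↔ (from B↔ (h x))              ≡⟨ strictlyInverseˡ B↔ (h x) ⟩
    h x                                ∎
    where
    open ≡-Reasoning
    i : Fin m
    i = from A↔ x

module _ (P : FiniteSpace) where
  open FiniteSpace P using (Pt; size; isPartialOrder) renaming (_≤_ to _≼_; _≤?_ to _≼?_)
  open IsPartialOrder isPartialOrder using () renaming (refl to ≼-refl; trans to ≼-trans)

  Pt² : Set
  Pt² = Pt × Pt

  _≤²_ : Pt² → Pt² → Set
  _≤²_ = _≤×_ P

  ≤²-refl : Reflexive _≤²_
  ≤²-refl = ≼-refl , ≼-refl

  ≤²-trans : ∀ {x y z} → x ≤² y → y ≤² z → x ≤² z
  ≤²-trans (a≼c , b≼d) (c≼e , d≼f) = ≼-trans a≼c c≼e , ≼-trans b≼d d≼f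

  record Walk (ℓ : ℕ) (x y : Pt) : Set where
    field
      walk   : ℕ → Pt
      zigzag : Zigzag _≼_ walk
      start  : walk 0 ≡ x
      stop   : ∀ t → ℓ ≤ t → walk t ≡ y

  pathWalk : ∀ {k x y} (γ : PathSpace P k) → q P k γ ≡ (x , y) → Walk k x y
  pathWalk {k} (γ , γ-mono) ends = record
    { walk   = γ ∘ clamp k
    ; zigzag = λ t → alt-map γ γ-mono t (clamp-zigzag k t)
    ; start  = trans (cong γ (clamp-zero k)) (cong proj₁ ends)
    ; stop   = λ t k≤t → trans (cong γ (clamp-top k≤t)) (cong proj₂ ends)
    }

  shortenWalk : ∀ {k x y} → Walk k x y → Walk (double size) x y
  shortenWalk {k} w = record
    { walk   = walk ∘ reindex
    ; zigzag = zigzag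
    ; start  = trans (cong walk reindex-zero) start
    ; stop   = λ t 2s≤t → stop (reindex t) (reaches t 2s≤t)
    }
    where
    open Walk w using (walk; start; stop)
    open LoopErasure _≡_ (resp₂ _≼_) id id
    open Shortcut (shortcut k walk (Walk.zigzag w))

  walkBetween : PathConnected P → ∀ x y → Walk (double size) x y
  walkBetween pc x y = shortenWalk (pathWalk (proj₁ (proj₂ (pc x y))) (proj₂ (proj₂ (pc x y))))

  -- The stages are total maps, so that they range over a finite set; only their
  -- restrictions to V matter.
  record Contraction (V : Pred Pt² 0ℓ) (z₀ : Pt²) (ℓ : ℕ) : Set where
    field
      stage    : ℕ → Pt² → Pt²
      zigzag   : Zigzag (Pointwise _≤²_) stage
      start    : ∀ z → stage 0 z ≡ z
      stop     : ∀ t → ℓ ≤ t → ∀ z → V z → stage t z ≡ z₀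
      monotone : ∀ t → Monotone (SubOrd _≤²_ V) _≤²_ (stage t ∘ proj₁)

  module _ {V : Pred Pt² 0ℓ} (V? : Decidable V) where

    extend : (Sub V → Pt²) → Pt² → Pt²
    extend g z with V? z
    ... | yes v = g (z , v)
    ... | no _  = z

    extend-alt : ∀ t {g h} → (∀ u → Alt _≤²_ t (g u) (h u)) →
                 Alt (Pointwise _≤²_) t (extend g) (extend h)
    extend-alt t {g} {h} gh = alt-pointwise t pointwise
      where
      pointwise : ∀ z → Alt _≤²_ t (extend g z) (extend h z)
      pointwise z with V? z
      ... | yes v = gh (z , v)
      ... | no _  = alt-refl ≤²-refl t

    extend-id : ∀ {g} → (∀ u → g u ≡ proj₁ u) → ∀ z → extend g z ≡ z
    extend-id g≗proj₁ z with V? z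
    ... | yes v = g≗proj₁ (z , v)
    ... | no _  = refl

    extend-const : ∀ {g z₀} → (∀ u → g u ≡ z₀) → ∀ z → V z → extend g z ≡ z₀
    extend-const g≗z₀ z v with V? z
    ... | yes v′ = g≗z₀ (z , v′)
    ... | no ¬v  = ⊥-elim (¬v v)

    extend-monotone : ∀ {g} → Monotone (SubOrd _≤²_ V) _≤²_ g →
                      Monotone (SubOrd _≤²_ V) _≤²_ (extend g ∘ proj₁)
    extend-monotone g-mono {z , v} {z′ , v′} z≤z′ with V? z | V? z′
    ... | yes _  | yes _   = g-mono z≤z′
    ... | no ¬v  | _       = ⊥-elim (¬v v)
    ... | yes _  | no ¬v′  = ⊥-elim (¬v′ v′)

  contractionOf : ∀ {U V} → Decidable V → V ⊆ U → ContractibleIn² P U →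
                  Σ Pt² λ z₀ → Σ ℕ λ k → Contraction V z₀ k
  contractionOf {U} {V} V? V⊆U (z₀ , k , H , H-mono , H-fence , H-start , H-stop) = z₀ , k , record
    { stage    = stage
    ; zigzag   = λ t → extend-alt V? t λ u → alt-map (λ c → H c (restrict u))
                   (λ c≤c′ → H-fence c≤c′ (restrict u)) t (clamp-zigzag k t)
    ; start    = extend-id V? λ u →
                   trans (cong (λ c → H c (restrict u)) (clamp-zero k)) (H-start _)
    ; stop     = λ t k≤t → extend-const V? λ u →
                   trans (cong (λ c → H c (restrict u)) (clamp-top k≤t)) (H-stop _)
    ; monotone = λ t {u} {u′} → extend-monotone V? (H-mono (clamp k t)) {u} {u′}
    }
    where
    restrict : Sub V → Sub U
    restrict (z , v) = z , V⊆U v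
    stage : ℕ → Pt² → Pt²
    stage t = extend V? (H (clamp k t) ∘ restrict)

  codeSize : ℕ
  codeSize = (size * size) ^ (size * size)

  shortenContraction : ∀ {V z₀ k} → Contraction V z₀ k → Contraction V z₀ (double codeSize)
  shortenContraction {k = k} C = record
    { stage    = stage ∘ reindex
    ; zigzag   = zigzag
    ; start    = λ z → trans (cong (λ t → stage t z) reindex-zero) (start z)
    ; stop     = λ t 2N≤t → stop (reindex t) (reaches t 2N≤t)
    ; monotone = monotone ∘ reindex
    }
    where
    open Contraction C using (stage; start; stop; monotone)
    open LoopErasure _≗_ (pointwise-resp-≗ {R = _≤²_})
      (funCode *↔× *↔×) (funCode-injective *↔× *↔×)
    open Shortcut (shortcut k stage (Contraction.zigzag C))

  sectionLength : ℕ
  sectionLength = double codeSize + (double size + double codeSize)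

  module _ {V a b} (C : Contraction V (a , b) (double codeSize)) (w : Walk (double size) a b) where
    open Contraction C
    open Walk w using (walk) renaming (zigzag to walk-zigzag; start to walk-start; stop to walk-stop)

    first second return route : Pt² → ℕ → Pt
    first  z t = proj₁ (stage t z)
    second z t = proj₂ (stage t z)
    return z   = splice size walk (reverse codeSize (second z))
    route  z   = splice codeSize (first z) (return z)

    stage-zigzag : ∀ z → Zigzag _≤²_ (λ t → stage t z)
    stage-zigzag z t = alt-map (λ g → g z) (λ g≤h → g≤h z) t (zigzag t)

    walk-junction : ∀ z → V z → walk (double size) ≡ second z (double codeSize)
    walk-junction z v = trans (walk-stop _ ≤-refl) (sym (cong proj₂ (stop _ ≤-refl z v)))

    contraction-junction : ∀ z → V z → first z (double codeSize) ≡ return z 0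
    contraction-junction z v = begin
      first z (double codeSize) ≡⟨ cong proj₁ (stop _ ≤-refl z v) ⟩
      a                         ≡⟨ walk-start ⟨
      walk 0                    ≡⟨ splice-zero size walk _ (walk-junction z v) ⟨
      return z 0                ∎
      where open ≡-Reasoning

    route-zigzag : ∀ z → V z → Zigzag _≼_ (route z)
    route-zigzag z v = splice-zigzag codeSize
      (λ t → alt-map proj₁ proj₁ t (stage-zigzag z t))
      (splice-zigzag size walk-zigzag
        (reverse-zigzag codeSize ≼-refl (λ t → alt-map proj₂ proj₂ t (stage-zigzag z t)))
        (walk-junction z v))
      (contraction-junction z v)

    route-start : ∀ z → V z → route z 0 ≡ proj₁ z
    route-start z v =
      trans (splice-zero codeSize (first z) (return z) (contraction-junction z v)) (cong proj₁ (start z))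

    route-end : ∀ z o → route z (sectionLength + o) ≡ proj₂ z
    route-end z o = begin
      route z (sectionLength + o)
        ≡⟨ cong (route z) (trans (+-assoc (double codeSize) _ o)
                                 (cong (double codeSize +_) (+-assoc (double size) _ o))) ⟩
      route z (double codeSize + (double size + (double codeSize + o)))
        ≡⟨ splice-+double codeSize (first z) (return z) _ ⟩
      return z (double size + (double codeSize + o))
        ≡⟨ splice-+double size walk (reverse codeSize (second z)) _ ⟩
      reverse codeSize (second z) (double codeSize + o)
        ≡⟨ reverse-+double codeSize (second z) o ⟩
      proj₂ (stage 0 z)
        ≡⟨ cong proj₂ (start z) ⟩
      proj₂ z ∎
      where open ≡-Reasoning

    route-monotone : Monotone (SubOrd _≤²_ V) (Pointwise _≼_) (route ∘ proj₁)
    route-monotone {u} {u′} u≤u′ = splice-pointwise {R = _≼_} codeSize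
      (λ t → proj₁ (monotone t {u} {u′} u≤u′))
      (splice-pointwise {R = _≼_} size (λ _ → ≼-refl)
        (λ t → proj₂ (monotone (double codeSize ∸ t) {u} {u′} u≤u′)))

    section : ∀ m → sectionLength ≤ m → HasSection P m V
    section m M≤m = path , (λ {u} {u′} u≤u′ j → route-monotone {u} {u′} u≤u′ (toℕ j)) , ends
      where
      path : Sub V → PathSpace P m
      path (z , v) = route z ∘ toℕ , zigzag⇒monotone ≼-refl (route-zigzag z v) m
      ends : ∀ u → q P m (path u) ≡ proj₁ u
      ends (z , v) with o , M+o≡m ← m≤n⇒∃[o]m+o≡n M≤m = cong₂ _,_ (route-start z v)
        (trans (cong (route z) (trans (toℕ-fromℕ m) (sym M+o≡m))) (route-end z o))

  sectionOfContractible : PathConnected P → ∀ {U V} → Decidable V → V ⊆ U →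
                          ContractibleIn² P U → ∀ m → sectionLength ≤ m → HasSection P m V
  sectionOfContractible pc V? V⊆U U-contractible with contractionOf V? V⊆U U-contractible
  ... | (a , b) , _ , C = section (shortenContraction C) (walkBetween pc a b)

  -- A contraction of U is only defined on U; the down-closed fibres of a choice of cover
  -- element form a decidable refinement, over which contractions extend to total maps.
  module _ {n} (choice : Pt² → Fin n) where

    ↓fibre : Fin n → Pred Pt² 0ℓ
    ↓fibre i z = ∃ λ z′ → z ≤² z′ × choice z′ ≡ i

    ↓fibre-open : ∀ i → IsOpen² P (↓fibre i)
    ↓fibre-open i x≤y (z′ , y≤z′ , chosen) = z′ , ≤²-trans x≤y y≤z′ , chosen

    ↓fibre-covers : ∀ z → ∃ λ i → ↓fibre i z
    ↓fibre-covers z = choice z , z , ≤²-refl , refl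

    ↓fibre? : ∀ i → Decidable (↓fibre i)
    ↓fibre? i (x , y) = map′ (λ (c , d , r) → (c , d) , r) (λ ((c , d) , r) → c , d , r)
      (any? λ c → any? λ d → ((x ≼? c) ×-dec (y ≼? d)) ×-dec (choice (c , d) ≟ᶠ i))

    ↓fibre-⊆ : ∀ {U : Fin n → Pred Pt² 0ℓ} → (∀ i → IsOpen² P (U i)) →
               (∀ z → U (choice z) z) → ∀ i → ↓fibre i ⊆ U i
    ↓fibre-⊆ U-open chosen i (z′ , z≤z′ , refl) = U-open (choice z′) z≤z′ (chosen z′)

lemma2p5 : (P : FiniteSpace) → PathConnected P →
    Σ ℕ (λ M → ∀ m → M ≤ m → ∀ n → CatCover P n → CCCover P m n)
lemma2p5 P pc = sectionLength P , cover
  where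
  cover : ∀ m → sectionLength P ≤ m → ∀ n → CatCover P n → CCCover P m n
  cover m M≤m n (U , U-open , U-covers , U-contractible) =
    ↓fibre P choice , ↓fibre-open P choice , ↓fibre-covers P choice , λ i →
      sectionOfContractible P pc (↓fibre? P choice i)
        (↓fibre-⊆ P choice U-open (proj₂ ∘ U-covers) i) (U-contractible i) m M≤m
    where
    choice : Pt² P → Fin n
    choice = proj₁ ∘ U-covers
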